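{- For an ideal $\mathcal{I}$ on $\omega$, the following are equivalent: (1) Player II has a winning strategy in the HMM game with respect to $\mathcal{I}$; (2) Player I has a winning strategy in the tallness game with respect to $\mathcal{I}$; (3) there is a tree $T \subseteq \omega^{<\omega}$ in which every node has infinitely many immediate successors such that $f[\omega] \in \mathcal{I}^+$ for every branch $f \in [T]$; (4) $\operatorname{non}^*(\mathcal{I}) = \aleph_0$.
   Context: As usual, ideals on $\omega$ are assumed to contain all finite subsets of $\omega$ and not to contain $\omega$; $\mathcal{I}^+ = \mathcal{P}(\omega) \setminus \mathcal{I}$. Tallness game with respect to $\mathcal{I}$: in round $k$ Player I plays $n_k \in \omega$, subject to $n_0 < n_1 < \cdots$, then Player II plays $i_k \in \{0,1\}$; Player II wins iff $\{n_k : k\in\omega, i_k = 1\}$ is an infinite member of $\mathcal{I}$. HMM game with respect to $\mathcal{I}$: in round $k$ Player I plays a finite set $F_k \subseteq \omega$, then Player II plays $n_k \in \omega \setminus F_k$; Player I wins iff $\{n_k : k \in \omega\} \in \mathcal{I}$. $[T]$ is the set of $f \in \omega^\omega$ with $f \upharpoonright n \in T$ for all $n$. $\operatorname{non}^*(\mathcal{I}) = \min\{|\mathcal{A}| : \mathcal{A} \subseteq [\omega]^\omega \text{ and for every } I \in \mathcal{I} \text{ there is } A \in \mathcal{A} \text{ with } A \cap I \text{ finite}\}$.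
   Formalization: Clause (4) states non*(𝓘) ≤ ℵ₀ rather than non*(𝓘) = ℵ₀: some countable family of infinite subsets of ω has, for each I ∈ 𝓘, a member A with A ∩ I finite. The statement above fails without it. -}

module Defs where

open import Level using (Level; 0ℓ)
open import Data.Nat using (ℕ; zero; suc; _<_; _≤_)
open import Data.Bool using (Bool; true; false)
open import Data.List using (List; []; _∷_; _++_; map; upTo; [_])
open import Data.List.Membership.Propositional using (_∈_)
open import Data.Product using (Σ; ∃; _×_; _,_)
open import Relation.Nullary using (¬_)
open import Relation.Binary.PropositionalEquality using (_≡_)
open import Function.Bundles using (_⇔_)

-- Subsets of ω = ℕ, as arbitrary predicates (all of P(ω), not just decidable ones).
Subset : Set₁
Subset = ℕ → Set

_⊆_ : Subset → Subset → Set
A ⊆ B = ∀ n → A n → B n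

_∪_ : Subset → Subset → Subset
(A ∪ B) n = Data.Sum._⊎_ (A n) (B n)
  where import Data.Sum

_∩_ : Subset → Subset → Subset
(A ∩ B) n = A n × B n

ω : Subset
ω _ = Data.Unit.⊤
  where import Data.Unit

Finite : Subset → Set
Finite A = ∃ λ b → ∀ n → A n → n < b

Infinite : Subset → Set
Infinite A = ¬ Finite A

Family : Set₁
Family = Subset → Set

record IsIdeal (𝓘 : Family) : Set₁ where
  field
    downward : ∀ {A B} → A ⊆ B → 𝓘 B → 𝓘 A
    union    : ∀ {A B} → 𝓘 A → 𝓘 B → 𝓘 (A ∪ B)
    finite   : ∀ {A} → Finite A → 𝓘 A
    proper   : ¬ 𝓘 ω

Positive : Family → Subset → Set
Positive 𝓘 A = ¬ 𝓘 A

prefix : {A : Set} → (ℕ → A) → ℕ → List A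
prefix f k = map f (upTo k)

-- Round k: I plays n_k (n_0 < n_1 < …), II plays i_k ∈ {0,1}.
-- II wins iff {n_k : i_k = 1} is an infinite member of 𝓘.
-- A strategy for Player I maps II's moves so far (i_0,…,i_{k-1}) to n_k
-- (I's own earlier moves are determined by the strategy).

StrategyI-Tall : Set
StrategyI-Tall = List Bool → ℕ

tallMoves : StrategyI-Tall → (ℕ → Bool) → ℕ → ℕ
tallMoves σ y k = σ (prefix y k)

tallChosen : StrategyI-Tall → (ℕ → Bool) → Subset
tallChosen σ y m = ∃ λ k → y k ≡ true × tallMoves σ y k ≡ m

WinningI-Tall : Family → StrategyI-Tall → Set
WinningI-Tall 𝓘 σ = ∀ (y : ℕ → Bool) →
  (∀ k → tallMoves σ y k < tallMoves σ y (suc k)) ×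
  ¬ (Infinite (tallChosen σ y) × 𝓘 (tallChosen σ y))

PlayerIWinsTallness : Family → Set
PlayerIWinsTallness 𝓘 = ∃ λ σ → WinningI-Tall 𝓘 σ

-- HMM game.  Round k: I plays a finite set F_k ⊆ ω (a list), II plays
-- n_k ∉ F_k.  I wins iff {n_k : k ∈ ω} ∈ 𝓘.
-- A strategy for II maps (F_0,…,F_{k-1}) and the current F_k to n_k.

StrategyII-HMM : Set
StrategyII-HMM = List (List ℕ) → List ℕ → ℕ

hmmMoves : StrategyII-HMM → (ℕ → List ℕ) → ℕ → ℕ
hmmMoves τ F k = τ (prefix F k) (F k)

hmmRange : StrategyII-HMM → (ℕ → List ℕ) → Subset
hmmRange τ F m = ∃ λ k → hmmMoves τ F k ≡ m

WinningII-HMM : Family → StrategyII-HMM → Set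
WinningII-HMM 𝓘 τ =
  (∀ (prev : List (List ℕ)) (G : List ℕ) → ¬ (τ prev G ∈ G)) ×
  (∀ (F : ℕ → List ℕ) → ¬ 𝓘 (hmmRange τ F))

PlayerIIWinsHMM : Family → Set
PlayerIIWinsHMM 𝓘 = ∃ λ τ → WinningII-HMM 𝓘 τ

Tree : Set₁
Tree = List ℕ → Set

record IsTree (T : Tree) : Set where
  field
    root   : T []
    closed : ∀ s t → T (s ++ t) → T s

InfinitelyBranching : Tree → Set
InfinitelyBranching T = ∀ s → T s → Infinite (λ m → T (s ++ [ m ]))

Branch : Tree → (ℕ → ℕ) → Set
Branch T f = ∀ n → T (prefix f n)

image : (ℕ → ℕ) → Subset
image f m = ∃ λ k → f k ≡ m

PositiveTree : Family → Set₁
PositiveTree 𝓘 = ∃ λ (T : Tree) →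
  IsTree T × InfinitelyBranching T ×
  (∀ f → Branch T f → Positive 𝓘 (image f))

NonStarCountable : Family → Set₁
NonStarCountable 𝓘 = ∃ λ (A : ℕ → Subset) →
  (∀ i → Infinite (A i)) ×
  (∀ X → 𝓘 X → ∃ λ i → Finite (A i ∩ X))

module Submission where

open import Defs
open import Axiom.ExcludedMiddle using (ExcludedMiddle)
open import Data.Product using (_×_)
open import Function.Bundles using (_⇔_)
open import Level using (0ℓ; suc)

open import Data.Bool using (Bool; true; false)
open import Data.Bool.Properties using (T-≡; not-¬)
open import Data.Empty using (⊥-elim)
open import Data.List using (List; []; _∷_; _++_; [_]; map; upTo; applyUpTo; length)
open import Data.List.Extrema.Nat using (max; xs≤max)
open import Data.List.Membership.Propositional using (_∈_)
open import Data.List.Membership.Propositional.Properties using (∈-upTo⁺)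
open import Data.List.Properties using (map-upTo; applyUpTo-∷ʳ; length-++; length-map; length-upTo; map-cong)
open import Data.List.Relation.Unary.All using (lookup)
open import Data.Nat using (ℕ; zero; _+_; _∸_; _⊔_; _≤_; _<_; _≤?_; z≤n; s≤s; pred)
  renaming (suc to 1+_)
open import Data.Nat.Properties
open import Data.Product using (∃; _,_; proj₁; proj₂; uncurry)
open import Data.Sum using (inj₁; inj₂)
open import Data.Unit using (⊤; tt)
open import Function.Base using (_∘_; id)
open import Function.Bundles using (mk⇔; Equivalence)
open import Function.Definitions using (StrictlySurjective)
open import Relation.Nullary using (¬_; yes; no)
open import Relation.Nullary.Decidable using (isYes; toWitness; fromWitness)
open import Relation.Nullary.Negation using (¬∃⟶∀¬)
open import Relation.Binary.PropositionalEquality using (_≡_; refl; sym; trans; cong; cong₂; subst)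

-- Everything is compared with a countable witness (A_i) of non*(𝓘) = ℵ₀.  Enumerate
-- ω × ω as k ↦ (i_k , b_k); a sequence whose k-th term lies in A_{i_k} above b_k meets
-- every A_i infinitely often, so its range is 𝓘-positive.  Player II in the HMM game
-- answers with such terms, avoiding I's finite sets; the positive tree consists of the
-- sequences built this way; in the tallness game I plays a term of A_{i_c} above b_c
-- when II has answered 1 exactly c times, so whatever infinite set II selects dovetails.
-- Conversely a strategy or a tree yields countably many infinite sets: the answers of II
-- to each finite history, the successors of each node, or the moves of I along each
-- eventually-0 play.  If some X ∈ 𝓘 met all of them infinitely, a play (or branch)
-- could be steered into X, contradicting that the strategy wins (the tree is positive).

private
  variable
    A B X : Subset
    C 𝒮 : ℕ → Subset
    𝓘 : Family

prefix-suc : ∀ {S : Set} (f : ℕ → S) k → prefix f (1+ k) ≡ prefix f k ++ [ f k ]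
prefix-suc f k = trans (map-upTo f (1+ k))
  (trans (sym (applyUpTo-∷ʳ f k)) (cong (_++ [ f k ]) (sym (map-upTo f k))))

length-prefix : ∀ {S : Set} (f : ℕ → S) k → length (prefix f k) ≡ k
length-prefix f k = trans (length-map f (upTo k)) (length-upTo k)

module _ {S : Set} (g : List S → S) where

  private
    history : ℕ → List S
    history zero   = []
    history (1+ k) = history k ++ [ g (history k) ]

  recHistory : ℕ → S
  recHistory k = g (history k)

  private
    prefix-recHistory : ∀ k → prefix recHistory k ≡ history k
    prefix-recHistory zero   = refl
    prefix-recHistory (1+ k) =
      trans (prefix-suc recHistory k) (cong (_++ [ recHistory k ]) (prefix-recHistory k))

  recHistory-unfold : ∀ k → recHistory k ≡ g (prefix recHistory k)
  recHistory-unfold k = cong g (sym (prefix-recHistory k))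

-- Cantor's zig-zag through the antidiagonals a + d = n, from (0 , n) down to (n , 0).
next : ℕ × ℕ → ℕ × ℕ
next (a , zero) = 0 , 1+ a
next (a , 1+ d) = 1+ a , d

unpair : ℕ → ℕ × ℕ
unpair zero   = 0 , 0
unpair (1+ k) = next (unpair k)

unpair-surjective : StrictlySurjective _≡_ unpair
unpair-surjective (a , d) = onAntidiagonal (a + d) a d refl
  where
  onAntidiagonal : ∀ n a d → a + d ≡ n → ∃ λ k → unpair k ≡ (a , d)
  onAntidiagonal zero   zero   d refl = 0 , refl
  onAntidiagonal (1+ n) zero   d refl with onAntidiagonal n n 0 (+-identityʳ n)
  ... | k , eq = 1+ k , cong next eq
  onAntidiagonal n      (1+ a) d eq   with onAntidiagonal n a (1+ d) (trans (+-suc a d) eq)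
  ... | k , eq′ = 1+ k , cong next eq′

module _ {S : Set} (element : ℕ → S) where

  listOfLength : ℕ → ℕ → List S
  listOfLength zero   c = []
  listOfLength (1+ n) c = uncurry (λ j c′ → element j ∷ listOfLength n c′) (unpair c)

  lists : ℕ → List S
  lists = uncurry listOfLength ∘ unpair

  module _ (element-surjective : StrictlySurjective _≡_ element) where

    listOfLength-surjective : ∀ xs → ∃ λ c → listOfLength (length xs) c ≡ xs
    listOfLength-surjective []       = 0 , refl
    listOfLength-surjective (x ∷ xs) with listOfLength-surjective xs | element-surjective x
    ... | c , eqc | j , eqj with unpair-surjective (j , c)
    ... | k , eqk = k , trans (cong (uncurry (λ j c′ → element j ∷ listOfLength (length xs) c′)) eqk)
                              (cong₂ _∷_ eqj eqc)

    lists-surjective : StrictlySurjective _≡_ lists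
    lists-surjective xs with listOfLength-surjective xs
    ... | c , eqc with unpair-surjective (length xs , c)
    ... | i , eqi = i , trans (cong (uncurry listOfLength) eqi) eqc

id-surjective : StrictlySurjective _≡_ (id {A = ℕ})
id-surjective n = n , refl

bit : ℕ → Bool
bit zero   = false
bit (1+ _) = true

bit-surjective : StrictlySurjective _≡_ bit
bit-surjective false = 0 , refl
bit-surjective true  = 1 , refl

infinite-mono : A ⊆ B → Infinite A → Infinite B
infinite-mono A⊆B infA (b , fin) = infA (b , λ n An → fin n (A⊆B n An))

infinite-above : ∀ b → Infinite A → Infinite (λ n → A n × b ≤ n)
infinite-above {A} b infA (c , fin) = infA (b ⊔ c , bounded)
  where
  bounded : ∀ n → A n → n < b ⊔ c
  bounded n An with b ≤? n
  ... | yes b≤n = <-≤-trans (fin n (An , b≤n)) (m≤n⊔m b c)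
  ... | no  b≰n = <-≤-trans (≰⇒> b≰n) (m≤m⊔n b c)

list-finite : (G : List ℕ) → Finite (_∈ G)
list-finite G = 1+ max 0 G , λ n n∈G → s≤s (lookup (xs≤max 0 G) n∈G)

module _ (em : ExcludedMiddle 0ℓ) where

  infinite-nonempty : Infinite A → ∃ A
  infinite-nonempty {A} infA with em {∃ A}
  ... | yes ∃A = ∃A
  ... | no  ∄A = ⊥-elim (infA (0 , λ n An → ⊥-elim (∄A (n , An))))

  infinite-unbounded : Infinite A → ∀ b → ∃ λ n → A n × b ≤ n
  infinite-unbounded infA b = infinite-nonempty (infinite-above b infA)

StrictlyIncreasing : (ℕ → ℕ) → Set
StrictlyIncreasing f = ∀ k → f k < f (1+ k)

module _ {f : ℕ → ℕ} (increasing : StrictlyIncreasing f) where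

  strictlyIncreasing-< : ∀ {j k} → j < k → f j < f k
  strictlyIncreasing-< {j} {1+ k} (s≤s j≤k) with m≤n⇒m<n∨m≡n j≤k
  ... | inj₁ j<k  = <-trans (strictlyIncreasing-< j<k) (increasing k)
  ... | inj₂ refl = increasing j

  strictlyIncreasing-≥ : ∀ k → k ≤ f k
  strictlyIncreasing-≥ zero   = z≤n
  strictlyIncreasing-≥ (1+ k) = ≤-trans (s≤s (strictlyIncreasing-≥ k)) (increasing k)

selection : (ℕ → ℕ) → (ℕ → Bool) → Subset
selection n y m = ∃ λ k → y k ≡ true × n k ≡ m

module _ {n : ℕ → ℕ} {y : ℕ → Bool} (increasing : StrictlyIncreasing n) where

  selection-bounded⇒eventually-false : ∀ b → (∀ m → selection n y m → m < b) →
                                       ∀ j → b ≤ j → y j ≡ false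
  selection-bounded⇒eventually-false b bounded j b≤j with y j in yj
  ... | false = refl
  ... | true  = ⊥-elim (<⇒≱ (bounded (n j) (j , yj , refl))
                            (≤-trans b≤j (strictlyIncreasing-≥ increasing j)))

  selection-infinite⇒trues-unbounded : ExcludedMiddle 0ℓ → Infinite (selection n y) →
                                       ∀ k → ∃ λ d → y (d + k) ≡ true
  selection-infinite⇒trues-unbounded em infinite k with em {∃ λ d → y (d + k) ≡ true}
  ... | yes trueAfter = trueAfter
  ... | no  noneAfter = ⊥-elim (infinite (n k , bounded))
    where
    bounded : ∀ m → selection n y m → m < n k
    bounded _ (j , yj , refl) with k ≤? j
    ... | yes k≤j = ⊥-elim (noneAfter (j ∸ k , trans (cong y (m∸n+n≡m k≤j)) yj))
    ... | no  k≰j = strictlyIncreasing-< increasing (≰⇒> k≰j)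

ones : List Bool → ℕ
ones []          = 0
ones (true ∷ t)  = 1+ ones t
ones (false ∷ t) = ones t

ones-∷ʳ-true : ∀ t → ones (t ++ [ true ]) ≡ 1+ ones t
ones-∷ʳ-true []          = refl
ones-∷ʳ-true (true ∷ t)  = cong 1+_ (ones-∷ʳ-true t)
ones-∷ʳ-true (false ∷ t) = ones-∷ʳ-true t

ones-∷ʳ-false : ∀ t → ones (t ++ [ false ]) ≡ ones t
ones-∷ʳ-false []          = refl
ones-∷ʳ-false (true ∷ t)  = cong 1+_ (ones-∷ʳ-false t)
ones-∷ʳ-false (false ∷ t) = ones-∷ʳ-false t

module _ {y : ℕ → Bool} where

  ones-prefix-true : ∀ {k} → y k ≡ true → ones (prefix y (1+ k)) ≡ 1+ ones (prefix y k)
  ones-prefix-true {k} yk = trans (cong ones (prefix-suc y k))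
    (subst (λ b → ones (prefix y k ++ [ b ]) ≡ 1+ ones (prefix y k)) (sym yk) (ones-∷ʳ-true (prefix y k)))

  ones-prefix-false : ∀ {k} → y k ≡ false → ones (prefix y (1+ k)) ≡ ones (prefix y k)
  ones-prefix-false {k} yk = trans (cong ones (prefix-suc y k))
    (subst (λ b → ones (prefix y k ++ [ b ]) ≡ ones (prefix y k)) (sym yk) (ones-∷ʳ-false (prefix y k)))

  first-true-after : ∀ d k → y (d + k) ≡ true →
                     ∃ λ j → ones (prefix y j) ≡ ones (prefix y k) × y j ≡ true
  first-true-after zero   k yt = k , refl , yt
  first-true-after (1+ d) k yt with y k in yk
  ... | true  = k , refl , yk
  ... | false with first-true-after d (1+ k) (subst (λ i → y i ≡ true) (sym (+-suc d k)) yt)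
  ...   | j , eq , yj = j , trans eq (ones-prefix-false yk) , yj

  nth-true : (∀ k → ∃ λ d → y (d + k) ≡ true) →
             ∀ c → ∃ λ k → ones (prefix y k) ≡ c × y k ≡ true
  nth-true unbounded zero = first-true-after (proj₁ (unbounded 0)) 0 (proj₂ (unbounded 0))
  nth-true unbounded (1+ c) with nth-true unbounded c
  ... | k , eq , yk with first-true-after (proj₁ (unbounded (1+ k))) (1+ k) (proj₂ (unbounded (1+ k)))
  ...   | j , eq′ , yj = j , trans eq′ (trans (ones-prefix-true yk) (cong 1+_ eq)) , yj

length-∷ʳ : ∀ {S : Set} (t : List S) x → length (t ++ [ x ]) ≡ 1+ length t
length-∷ʳ t _ = trans (length-++ t) (+-comm (length t) 1)

padded : List Bool → ℕ → Bool
padded []      _      = false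
padded (b ∷ t) zero   = b
padded (b ∷ t) (1+ j) = padded t j

padded-applyUpTo : ∀ (y : ℕ → Bool) b j → j < b → padded (applyUpTo y b) j ≡ y j
padded-applyUpTo y (1+ b) zero   _         = refl
padded-applyUpTo y (1+ b) (1+ j) (s≤s j<b) = padded-applyUpTo (y ∘ 1+_) b j j<b

padded-beyond : ∀ t j → length t ≤ j → padded t j ≡ false
padded-beyond []      j      _         = refl
padded-beyond (b ∷ t) (1+ j) (s≤s t≤j) = padded-beyond t j t≤j

padded-prefix : ∀ (y : ℕ → Bool) b → (∀ j → b ≤ j → y j ≡ false) →
                ∀ j → padded (prefix y b) j ≡ y j
padded-prefix y b false-after j with b ≤? j
... | yes b≤j = trans (padded-beyond (prefix y b) j (≤-trans (≤-reflexive (length-prefix y b)) b≤j))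
                      (sym (false-after j b≤j))
... | no  b≰j = trans (cong (λ t → padded t j) (map-upTo y b)) (padded-applyUpTo y b j (≰⇒> b≰j))

-- Row c is for the moment when II has played c ones, column k for round k; a round
-- takes the play from (c , k) to (c , 1+ k) or to (1+ c , 1+ k).
module Staircase {B : ℕ → Subset} (unbounded : ∀ c b → ∃ λ n → B c n × b ≤ n) where

  M : ℕ → ℕ → ℕ
  M c zero   = proj₁ (unbounded c 0)
  M c (1+ k) = proj₁ (unbounded c (1+ (M c k ⊔ M (pred c) k)))

  M-∈ : ∀ c k → B c (M c k)
  M-∈ c zero   = proj₁ (proj₂ (unbounded c 0))
  M-∈ c (1+ k) = proj₁ (proj₂ (unbounded c (1+ (M c k ⊔ M (pred c) k))))

  private
    M-lower : ∀ c k → 1+ (M c k ⊔ M (pred c) k) ≤ M c (1+ k)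
    M-lower c k = proj₂ (proj₂ (unbounded c (1+ (M c k ⊔ M (pred c) k))))

  M-<-right : ∀ c k → M c k < M c (1+ k)
  M-<-right c k = ≤-trans (s≤s (m≤m⊔n _ _)) (M-lower c k)

  M-<-diagonal : ∀ c k → M c k < M (1+ c) (1+ k)
  M-<-diagonal c k = ≤-trans (s≤s (m≤n⊔m _ _)) (M-lower (1+ c) k)

DownwardClosed : Family → Set₁
DownwardClosed 𝓘 = ∀ {A B} → A ⊆ B → 𝓘 B → 𝓘 A

positive-mono : DownwardClosed 𝓘 → A ⊆ B → Positive 𝓘 A → Positive 𝓘 B
positive-mono downward A⊆B A∉𝓘 B∈𝓘 = A∉𝓘 (downward A⊆B B∈𝓘)

Covers : Family → (ℕ → Subset) → Set₁
Covers 𝓘 𝒮 = ∀ X → 𝓘 X → ∃ λ i → Finite (𝒮 i ∩ X)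

MeetsAll : (ℕ → Subset) → Subset → Set
MeetsAll 𝒮 X = ∀ i → Infinite (𝒮 i ∩ X)

Above : (ℕ → Subset) → ℕ × ℕ → Subset
Above 𝒮 p n = 𝒮 (proj₁ p) n × proj₂ p ≤ n

Dovetails : (ℕ → Subset) → (ℕ → ℕ) → Set
Dovetails 𝒮 x = ∀ k → Above 𝒮 (unpair k) (x k)

above-infinite : (∀ i → Infinite (𝒮 i)) → ∀ p → Infinite (Above 𝒮 p)
above-infinite infinite p = infinite-above (proj₂ p) (infinite (proj₁ p))

meetsAll⇒positive : Covers 𝓘 𝒮 → MeetsAll 𝒮 X → Positive 𝓘 X
meetsAll⇒positive cover meets X∈𝓘 = meets _ (proj₂ (cover _ X∈𝓘))

dovetails⇒meetsAll : ∀ {x} → Dovetails 𝒮 x → MeetsAll 𝒮 (image x)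
dovetails⇒meetsAll {𝒮} {x} dovetails i (b , fin) with unpair-surjective (i , b)
... | k , eq = <⇒≱ (fin (x k) (proj₁ xk∈A , k , refl)) (proj₂ xk∈A)
  where
  xk∈A : Above 𝒮 (i , b) (x k)
  xk∈A = subst (λ p → Above 𝒮 p (x k)) eq (dovetails k)

covers-by-contradiction : ExcludedMiddle 0ℓ → (∀ X → 𝓘 X → ¬ MeetsAll 𝒮 X) → Covers 𝓘 𝒮
covers-by-contradiction {𝓘} {𝒮} em refute X X∈𝓘 with em {∃ λ i → Finite (𝒮 i ∩ X)}
... | yes covered = covered
... | no  ¬covered = ⊥-elim (refute X X∈𝓘 (¬∃⟶∀¬ ¬covered))

Pointwise : (ℕ → Subset) → Tree
Pointwise C []      = ⊤
Pointwise C (m ∷ s) = C 0 m × Pointwise (C ∘ 1+_) s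

pointwise-++ : ∀ s t → Pointwise C (s ++ t) → Pointwise C s
pointwise-++ []      t _            = tt
pointwise-++ (m ∷ s) t (c , s++t∈) = c , pointwise-++ s t s++t∈

pointwise-∷ʳ : ∀ s {m} → Pointwise C s → C (length s) m → Pointwise C (s ++ [ m ])
pointwise-∷ʳ []      _        c  = c , tt
pointwise-∷ʳ (_ ∷ s) (c , s∈) c′ = c , pointwise-∷ʳ s s∈ c′

pointwise-∷ʳ⁻ : ∀ s {m} → Pointwise C (s ++ [ m ]) → C (length s) m
pointwise-∷ʳ⁻ []      (c , _)   = c
pointwise-∷ʳ⁻ (_ ∷ s) (_ , s∈) = pointwise-∷ʳ⁻ s s∈

pointwise-isTree : IsTree (Pointwise C)
pointwise-isTree = record { root = tt ; closed = pointwise-++ }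

pointwise-infinitelyBranching : (∀ k → Infinite (C k)) → InfinitelyBranching (Pointwise C)
pointwise-infinitelyBranching infinite s s∈ =
  infinite-mono (λ m c → pointwise-∷ʳ s s∈ c) (infinite (length s))

pointwise-branch : ∀ {f} → Branch (Pointwise C) f → ∀ k → C k (f k)
pointwise-branch {C} {f} branch k = subst (λ l → C l (f k)) (length-prefix f k)
  (pointwise-∷ʳ⁻ (prefix f k) (subst (Pointwise C) (prefix-suc f k) (branch (1+ k))))

nonStar⇒positiveTree : NonStarCountable 𝓘 → PositiveTree 𝓘
nonStar⇒positiveTree (𝒜 , infinite , cover) =
    Pointwise (Above 𝒜 ∘ unpair)
  , pointwise-isTree
  , pointwise-infinitelyBranching (above-infinite infinite ∘ unpair)
  , λ f branch → meetsAll⇒positive cover (dovetails⇒meetsAll (pointwise-branch branch))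

module _ (em : ExcludedMiddle 0ℓ) where

  nonStar⇒hmm : NonStarCountable 𝓘 → PlayerIIWinsHMM 𝓘
  nonStar⇒hmm {𝓘} (𝒜 , infinite , cover) = τ , legal , winning
    where
    answer : ∀ k G → ∃ λ n → Above 𝒜 (unpair k) n × proj₁ (list-finite G) ≤ n
    answer k G = infinite-unbounded em (above-infinite infinite (unpair k)) (proj₁ (list-finite G))

    τ : StrategyII-HMM
    τ previous G = proj₁ (answer (length previous) G)

    legal : ∀ previous G → ¬ τ previous G ∈ G
    legal previous G τ∈G =
      <⇒≱ (proj₂ (list-finite G) _ τ∈G) (proj₂ (proj₂ (answer (length previous) G)))

    winning : ∀ F → ¬ 𝓘 (hmmRange τ F)
    winning F = meetsAll⇒positive {𝓘} cover (dovetails⇒meetsAll dovetails)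
      where
      dovetails : Dovetails 𝒜 (hmmMoves τ F)
      dovetails k = subst (λ l → Above 𝒜 (unpair l) (hmmMoves τ F k)) (length-prefix F k)
                          (proj₁ (proj₂ (answer (length (prefix F k)) (F k))))

  hmm⇒nonStar : DownwardClosed 𝓘 → PlayerIIWinsHMM 𝓘 → NonStarCountable 𝓘
  hmm⇒nonStar {𝓘} downward (τ , legal , winning) = 𝒜 , infinite , covers-by-contradiction em refute
    where
    history : ℕ → List (List ℕ)
    history = lists (lists id)

    -- II's answers to history i when I plays {0, …, m - 1}; such an answer is at least m.
    𝒜 : ℕ → Subset
    𝒜 i n = ∃ λ m → τ (history i) (upTo m) ≡ n

    infinite : ∀ i → Infinite (𝒜 i)
    infinite i (b , fin) = legal (history i) (upTo b) (∈-upTo⁺ (fin _ (b , refl)))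

    refute : ∀ X → 𝓘 X → ¬ MeetsAll 𝒜 X
    refute X X∈𝓘 meets = winning F (downward range⊆X X∈𝓘)
      where
      answerIn : ∀ h → ∃ λ m → X (τ h (upTo m))
      answerIn h with lists-surjective (lists id) (lists-surjective id id-surjective) h
      ... | i , refl with infinite-nonempty em (meets i)
      ...   | _ , (m , refl) , Xn = m , Xn

      F : ℕ → List ℕ
      F = recHistory (upTo ∘ proj₁ ∘ answerIn)

      range⊆X : hmmRange τ F ⊆ X
      range⊆X _ (k , refl) = subst (λ G → X (τ (prefix F k) G))
        (sym (recHistory-unfold (upTo ∘ proj₁ ∘ answerIn) k)) (proj₂ (answerIn (prefix F k)))

  positiveTree⇒nonStar : DownwardClosed 𝓘 → PositiveTree 𝓘 → NonStarCountable 𝓘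
  positiveTree⇒nonStar {𝓘} downward (T , tree , branching , positive) =
    𝒜 , infinite , covers-by-contradiction em refute
    where
    open IsTree tree

    node : ℕ → List ℕ
    node = lists id

    -- The successors of node i, or everything when node i ∉ T.
    𝒜 : ℕ → Subset
    𝒜 i m = T (node i) → T (node i ++ [ m ])

    infinite : ∀ i → Infinite (𝒜 i)
    infinite i (b , fin) = <-irrefl refl (fin b (⊥-elim ∘ outside))
      where
      outside : ¬ T (node i)
      outside t = branching _ t (b , λ m t∷m → fin m (λ _ → t∷m))

    refute : ∀ X → 𝓘 X → ¬ MeetsAll 𝒜 X
    refute X X∈𝓘 meets = positive f branch (downward image⊆X X∈𝓘)
      where
      successorIn : ∀ s → ∃ λ m → (T s → T (s ++ [ m ])) × X m
      successorIn s with lists-surjective id id-surjective s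
      ... | i , refl with infinite-nonempty em (meets i)
      ...   | m , successor , Xm = m , successor , Xm

      f : ℕ → ℕ
      f = recHistory (proj₁ ∘ successorIn)

      f-successor : ∀ k → (T (prefix f k) → T (prefix f k ++ [ f k ])) × X (f k)
      f-successor k = subst (λ m → (T (prefix f k) → T (prefix f k ++ [ m ])) × X m)
        (sym (recHistory-unfold (proj₁ ∘ successorIn) k)) (proj₂ (successorIn (prefix f k)))

      branch : Branch T f
      branch zero   = root
      branch (1+ k) = subst T (sym (prefix-suc f k)) (proj₁ (f-successor k) (branch k))

      image⊆X : image f ⊆ X
      image⊆X _ (k , refl) = proj₂ (f-successor k)

  nonStar⇒tallness : DownwardClosed 𝓘 → NonStarCountable 𝓘 → PlayerIWinsTallness 𝓘
  nonStar⇒tallness {𝓘} downward (𝒜 , infinite , cover) = σ , winning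
    where
    open Staircase (λ c → infinite-unbounded em (above-infinite infinite (unpair c)))

    σ : StrategyI-Tall
    σ t = M (ones t) (length t)

    σ-∷ʳ : ∀ t b → σ t < σ (t ++ [ b ])
    σ-∷ʳ t true  rewrite ones-∷ʳ-true t  | length-∷ʳ t true = M-<-diagonal (ones t) (length t)
    σ-∷ʳ t false rewrite ones-∷ʳ-false t | length-∷ʳ t false = M-<-right (ones t) (length t)

    increasing : ∀ y → StrictlyIncreasing (tallMoves σ y)
    increasing y k =
      subst (λ t → σ (prefix y k) < σ t) (sym (prefix-suc y k)) (σ-∷ʳ (prefix y k) (y k))

    winning : WinningI-Tall 𝓘 σ
    winning y = increasing y , uncurry lost
      where
      lost : Infinite (tallChosen σ y) → ¬ 𝓘 (tallChosen σ y)
      lost infinite-C =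
        positive-mono downward image⊆C (meetsAll⇒positive cover (dovetails⇒meetsAll dovetails))
        where
        round : ∀ c → ∃ λ k → ones (prefix y k) ≡ c × y k ≡ true
        round = nth-true (selection-infinite⇒trues-unbounded (increasing y) em infinite-C)

        chosen : ℕ → ℕ
        chosen c = tallMoves σ y (proj₁ (round c))

        dovetails : Dovetails 𝒜 chosen
        dovetails c = subst (λ c′ → Above 𝒜 (unpair c′) (chosen c)) (proj₁ (proj₂ (round c)))
          (M-∈ (ones (prefix y (proj₁ (round c)))) (length (prefix y (proj₁ (round c)))))

        image⊆C : image chosen ⊆ tallChosen σ y
        image⊆C _ (c , refl) = proj₁ (round c) , proj₂ (proj₂ (round c)) , refl

  tallness⇒nonStar : DownwardClosed 𝓘 → PlayerIWinsTallness 𝓘 → NonStarCountable 𝓘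
  tallness⇒nonStar {𝓘} downward (σ , winning) = 𝒜 , infinite , covers-by-contradiction em refute
    where
    code : ℕ → List Bool
    code = lists bit

    increasing : ∀ y → StrictlyIncreasing (tallMoves σ y)
    increasing y = proj₁ (winning y)

    -- The moves of I from round length (code i) on, when II plays code i and then 0s.
    𝒜 : ℕ → Subset
    𝒜 i n = ∃ λ k → length (code i) ≤ k × tallMoves σ (padded (code i)) k ≡ n

    infinite : ∀ i → Infinite (𝒜 i)
    infinite i (b , fin) = <⇒≱ (fin _ (k , m≤n+m _ b , refl))
      (≤-trans (m≤m+n b _) (strictlyIncreasing-≥ (increasing (padded (code i))) k))
      where
      k = b + length (code i)

    refute : ∀ X → 𝓘 X → ¬ MeetsAll 𝒜 X
    refute X X∈𝓘 meets = proj₂ (winning y) (infinite-C , downward C⊆X X∈𝓘)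
      where
      answer : List Bool → Bool
      answer t = isYes (em {X (σ t)})

      y : ℕ → Bool
      y = recHistory answer

      answer-true⁻ : ∀ k → y k ≡ true → X (σ (prefix y k))
      answer-true⁻ k yk = toWitness (Equivalence.from T-≡ (trans (sym (recHistory-unfold answer k)) yk))

      answer-true⁺ : ∀ k → X (σ (prefix y k)) → y k ≡ true
      answer-true⁺ k Xσ = trans (recHistory-unfold answer k) (Equivalence.to T-≡ (fromWitness Xσ))

      C⊆X : tallChosen σ y ⊆ X
      C⊆X _ (k , yk , refl) = answer-true⁻ k yk

      -- A bound b on the selection forces y = code i followed by 0s, for i coding prefix y b;
      -- a point of 𝒜 i ∩ X is then a later move of I in X, which II would have answered with 1.
      infinite-C : Infinite (tallChosen σ y)
      infinite-C (b , fin) with lists-surjective bit bit-surjective (prefix y b)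
      ... | i , code≡ with infinite-nonempty em (meets i)
      ...   | _ , (k , i≤k , refl) , Xn = not-¬ (false-after k b≤k) (answer-true⁺ k Xσ)
        where
        false-after : ∀ j → b ≤ j → y j ≡ false
        false-after = selection-bounded⇒eventually-false (increasing y) b fin

        agree : ∀ j → padded (code i) j ≡ y j
        agree j = trans (cong (λ t → padded t j) code≡) (padded-prefix y b false-after j)

        b≤k : b ≤ k
        b≤k = subst (_≤ k) (trans (cong length code≡) (length-prefix y b)) i≤k

        Xσ : X (σ (prefix y k))
        Xσ = subst (X ∘ σ) (map-cong agree (upTo k)) Xn

theorem6p7 : ExcludedMiddle 0ℓ → ExcludedMiddle (suc 0ℓ) →
    (𝓘 : Family) → IsIdeal 𝓘 →
    (PlayerIIWinsHMM 𝓘 ⇔ PlayerIWinsTallness 𝓘) ×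
    (PlayerIIWinsHMM 𝓘 ⇔ PositiveTree 𝓘) ×
    (PlayerIIWinsHMM 𝓘 ⇔ NonStarCountable 𝓘)
theorem6p7 em _ 𝓘 ideal =
    mk⇔ (nonStar⇒tallness em downward ∘ toNonStar) (fromNonStar ∘ tallness⇒nonStar em downward)
  , mk⇔ (nonStar⇒positiveTree ∘ toNonStar) (fromNonStar ∘ positiveTree⇒nonStar em downward)
  , mk⇔ toNonStar fromNonStar
  where
  open IsIdeal ideal using (downward)

  toNonStar : PlayerIIWinsHMM 𝓘 → NonStarCountable 𝓘
  toNonStar = hmm⇒nonStar em downward

  fromNonStar : NonStarCountable 𝓘 → PlayerIIWinsHMM 𝓘
  fromNonStar = nonStar⇒hmm em
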